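{- Let $n\ge2$, ${\cal I}=\{(i,j)\mid 1\le i\le n,\ 1\le j\le n+1\}$ and $S=\{(i,j)\in{\cal I}\mid i+j\le n+1\}$. Let $X\ne Y$ be tables in the same fiber and $Z=(z_{ij})=X-Y$. Suppose $Z$ satisfies condition (C), that a row $i_1$ as defined in the context exists, and that $z_{ij}\le0$ for all $(i,j)\in S$ with $i\ge i_1$. Then $$|z_{i_11}+z_{i_1,n+1}|\le\sum_{(i,j)\in\bar S^-_{i_1}}|z_{ij}|,$$ where $\bar S^-_{i_1}=\{(i,j)\in{\cal I}\setminus S\mid i<i_1,\ j\ne n+1,\ z_{ij}<0\}$.
   Context: Condition (C): there exists $i_0$ with $1\le i_0\le n$ such that $z_{i1}\ge0$ and $z_{i,n+1}\ge0$ for all $i\le i_0$, and $z_{i1}\le0$ and $z_{i,n+1}\le0$ for all $i>i_0$. The row $i_1$ is a row satisfying: $z_{i_11}\le0$ and $z_{i_1,n+1}\le0$; $z_{i_11}<0$ or $z_{i_1,n+1}<0$; and $z_{i1}=z_{i,n+1}=0$ for all $i>i_1$. A table is an array on ${\cal I}$ with entries in $\mathbb{N}=\{0,1,\dots\}$; the fiber of $X$ is the set of tables with the same row sums, column sums and sum of entries over $S$. -}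

module Defs where

open import Data.Nat using (ℕ; zero; suc; _+_; _≤_; _<_; _≤?_; _<?_; _≟_)
open import Data.Fin using (Fin; toℕ; fromℕ) renaming (zero to fzero; suc to fsuc)
open import Data.Integer as ℤ using (ℤ; +_; _-_; ∣_∣)
open import Data.Bool using (Bool; true; false; if_then_else_; _∧_; not)
open import Data.Product using (_×_)
open import Relation.Nullary.Decidable using (⌊_⌋)
open import Relation.Binary.PropositionalEquality using (_≡_)

Σ : {k : ℕ} → (Fin k → ℕ) → ℕ
Σ {zero}  f = 0
Σ {suc k} f = f fzero + Σ (λ i → f (fsuc i))

-- A table on I = {1..n} × {1..n+1}; Fin index i stands for the
-- paper's row (toℕ i + 1), column index j for column (toℕ j + 1).
Table : ℕ → Set
Table n = Fin n → Fin (suc n) → ℕ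

row : {n : ℕ} → Fin n → ℕ
row i = suc (toℕ i)

col : {n : ℕ} → Fin (suc n) → ℕ
col j = suc (toℕ j)

firstCol : {n : ℕ} → Fin (suc n)
firstCol = fzero

lastCol : {n : ℕ} → Fin (suc n)
lastCol {n} = fromℕ n

inS? : {n : ℕ} → Fin n → Fin (suc n) → Bool
inS? {n} i j = ⌊ row i + col j ≤? suc n ⌋

rowSum : {n : ℕ} → Table n → Fin n → ℕ
rowSum X i = Σ (λ j → X i j)

colSum : {n : ℕ} → Table n → Fin (suc n) → ℕ
colSum X j = Σ (λ i → X i j)

SSum : {n : ℕ} → Table n → ℕ
SSum X = Σ (λ i → Σ (λ j → if inS? i j then X i j else 0))

SameFiber : {n : ℕ} → Table n → Table n → Set
SameFiber X Y =
  ((i : _) → rowSum X i ≡ rowSum Y i) ×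
  ((j : _) → colSum X j ≡ colSum Y j) ×
  (SSum X ≡ SSum Y)

diff : {n : ℕ} → Table n → Table n → Fin n → Fin (suc n) → ℤ
diff X Y i j = + X i j - + Y i j

inSbarMinus? : {n : ℕ} → (Fin n → Fin (suc n) → ℤ) → Fin n →
               Fin n → Fin (suc n) → Bool
inSbarMinus? {n} z i₁ i j =
  not (inS? i j) ∧ ⌊ row i <? row i₁ ⌋ ∧ not ⌊ col j ≟ suc n ⌋
    ∧ ⌊ z i j ℤ.<? + 0 ⌋

SbarMinusSum : {n : ℕ} → (Fin n → Fin (suc n) → ℤ) → Fin n → ℕ
SbarMinusSum z i₁ =
  Σ (λ i → Σ (λ j → if inSbarMinus? z i₁ i j then ∣ z i j ∣ else 0))

-- Write u i for the sum of row i of Z over S plus its entry in column n+1.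
-- Equal column n+1 sums and equal sums over S make the u i add up to 0, and equal
-- row sums make u i minus the sum of the other entries of row i outside S.
-- For rows above i₁ this is at most the row's share of the right-hand side;
-- for rows below i₁ the hypotheses give u i ≤ 0; and u i₁ ≤ z_{i₁1} + z_{i₁,n+1},
-- since (i₁,1) is the only cell of row i₁ in S whose entry may be positive.
-- Summing, 0 ≤ (right-hand side) + z_{i₁1} + z_{i₁,n+1}, with the last two ≤ 0.
module Submission where

open import Defs
open import Data.Nat using (ℕ; suc; _≤_; _<_; _>_; _≥_)
open import Data.Bool using (true)
open import Data.Fin using (Fin)
open import Data.Integer as ℤ using (ℤ; +_; ∣_∣; _+_)
open import Data.Product using (Σ-syntax; _×_)
open import Data.Sum using (_⊎_)
open import Relation.Nullary using (¬_)
open import Relation.Binary.PropositionalEquality using (_≡_)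

open import Data.Nat as ℕ using (zero; _≟_; _≤?_; _<?_)
import Data.Nat.Properties as ℕ
open import Data.Fin using (toℕ; inject₁; punchIn) renaming (zero to fzero; suc to fsuc)
open import Data.Fin.Properties using (toℕ-injective; toℕ-fromℕ; fromℕ≢inject₁; punchInᵢ≢i; toℕ<n)
open import Data.Integer using (0ℤ; -_; _-_; -[1+_])
open import Data.Integer.Properties
  using ( +-0-commutativeMonoid; module ≤-Reasoning; ≤-refl; ≤-trans; ≤-reflexive; ≮⇒≥; drop‿+≤+
        ; +-identityˡ; +-identityʳ; +-inverseʳ; +-mono-≤; +-monoˡ-≤; +-monoʳ-≤; pos-+
        ; neg-distrib-+; neg-involutive; neg-mono-≤; neg-≤-pos; i-j≤i; i≤j⇒i-j≤0
        ; ∣-i∣≡∣i∣; 0≤i⇒+∣i∣≡i )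
open import Data.Integer.Solver using (module +-*-Solver)
open import Data.Bool using (Bool; false; if_then_else_; _∧_; not; T)
open import Data.Unit using (tt)
open import Data.Product using (_,_; uncurry)
open import Function using (_∘_)
open import Relation.Nullary using (Dec; yes; no; contradiction)
open import Relation.Nullary.Decidable using (⌊_⌋; dec-true; dec-false; isYes≗does; toWitness)
open import Relation.Binary using (tri<; tri≈; tri>)
open import Relation.Binary.PropositionalEquality
  using (refl; sym; trans; cong; cong₂; subst; _≢_; module ≡-Reasoning)
open import Algebra.Properties.CommutativeMonoid.Sum +-0-commutativeMonoid
  using (sum; ∑-distrib-+; sum-cong-≗; sum-remove; sum-replicate-zero; sum-init-last)

sum-neg : ∀ {k} (f : Fin k → ℤ) → sum (λ i → - f i) ≡ - sum f
sum-neg {zero}  f = refl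
sum-neg {suc k} f = trans (cong (_+_ (- f fzero)) (sum-neg (f ∘ fsuc)))
                           (sym (neg-distrib-+ (f fzero) (sum (f ∘ fsuc))))

pos-Σ : ∀ {k} (f : Fin k → ℕ) → + Σ f ≡ sum (λ i → + f i)
pos-Σ {zero}  f = refl
pos-Σ {suc k} f = trans (pos-+ (f fzero) (Σ (f ∘ fsuc)))
                         (cong (_+_ (+ f fzero)) (pos-Σ (f ∘ fsuc)))

sum-sub-pos : ∀ {k} (f g : Fin k → ℕ) → sum (λ i → + f i - + g i) ≡ + Σ f - + Σ g
sum-sub-pos f g = begin
  sum (λ i → + f i - + g i)             ≡⟨ ∑-distrib-+ (λ i → + f i) (λ i → - + g i) ⟩
  sum (λ i → + f i) + sum (λ i → - + g i) ≡⟨ cong (_+_ (sum (λ i → + f i))) (sum-neg (λ i → + g i)) ⟩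
  sum (λ i → + f i) - sum (λ i → + g i)   ≡⟨ sym (cong₂ _-_ (pos-Σ f) (pos-Σ g)) ⟩
  + Σ f - + Σ g                           ∎
  where open ≡-Reasoning

sum-sub-pos-≡0 : ∀ {k} (f g : Fin k → ℕ) → Σ f ≡ Σ g → sum (λ i → + f i - + g i) ≡ 0ℤ
sum-sub-pos-≡0 f g eq = trans (sum-sub-pos f g) (subst (λ s → + Σ f - + s ≡ 0ℤ) eq (+-inverseʳ (+ Σ f)))

sum-mono-≤ : ∀ {k} {f g : Fin k → ℤ} → (∀ i → f i ℤ.≤ g i) → sum f ℤ.≤ sum g
sum-mono-≤ {zero}  f≤g = ≤-refl
sum-mono-≤ {suc k} f≤g = +-mono-≤ (f≤g fzero) (sum-mono-≤ (f≤g ∘ fsuc))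

sum-nonpos : ∀ {k} {f : Fin k → ℤ} → (∀ i → f i ℤ.≤ 0ℤ) → sum f ℤ.≤ 0ℤ
sum-nonpos {k} f≤0 = ≤-trans (sum-mono-≤ f≤0) (≤-reflexive (sum-replicate-zero k))

+-nonpos-≤ : ∀ i {j} → j ℤ.≤ 0ℤ → i + j ℤ.≤ i
+-nonpos-≤ i j≤0 = ≤-trans (+-monoʳ-≤ i j≤0) (≤-reflexive (+-identityʳ i))

sum-≤-at : ∀ {k} {f : Fin k → ℤ} (i : Fin k) → (∀ j → j ≢ i → f j ℤ.≤ 0ℤ) → sum f ℤ.≤ f i
sum-≤-at {suc k} {f} i others≤0 = begin
  sum f                      ≡⟨ sum-remove {i = i} f ⟩
  f i + sum (f ∘ punchIn i)  ≤⟨ +-nonpos-≤ (f i) (sum-nonpos λ j → others≤0 _ (punchInᵢ≢i i j)) ⟩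
  f i                        ∎
  where open ≤-Reasoning

x+y+c≡0⇒x+c≡-y : ∀ {x y c} → x + y + c ≡ 0ℤ → x + c ≡ - y
x+y+c≡0⇒x+c≡-y {x} {y} {c} eq = begin
  x + c              ≡⟨ solve 3 (λ x y c → x :+ c := x :+ y :+ c :- y) refl x y c ⟩
  x + y + c - y      ≡⟨ cong (_- y) eq ⟩
  0ℤ - y             ≡⟨ +-identityˡ (- y) ⟩
  - y                ∎
  where open ≡-Reasoning
        open +-*-Solver

-i≤+∣i∣ : ∀ i → - i ℤ.≤ + ∣ i ∣
-i≤+∣i∣ (+ n)    = neg-≤-pos
-i≤+∣i∣ -[1+ n ] = ≤-refl

i≤0⇒+∣i∣≡-i : ∀ {i} → i ℤ.≤ 0ℤ → + ∣ i ∣ ≡ - i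
i≤0⇒+∣i∣≡-i {i} i≤0 = trans (cong +_ (sym (∣-i∣≡∣i∣ i))) (0≤i⇒+∣i∣≡i (neg-mono-≤ i≤0))

masked-≤0 : (b : Bool) {w : ℤ} → (b ≡ true → w ℤ.≤ 0ℤ) → (if b then w else 0ℤ) ℤ.≤ 0ℤ
masked-≤0 true  w≤0 = w≤0 refl
masked-≤0 false w≤0 = ≤-refl

masked-sub : (b : Bool) (x y : ℕ) →
  (if b then + x - + y else 0ℤ) ≡ + (if b then x else 0) - + (if b then y else 0)
masked-sub true  x y = refl
masked-sub false x y = refl

split-by-S-and-last : (s l : Bool) (w : ℤ) → (s ≡ true → l ≡ false) →
  w ≡ ((if s then w else 0ℤ) + (if not s ∧ not l then w else 0ℤ)) + (if l then w else 0ℤ)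
split-by-S-and-last true  l     w s⇒¬l rewrite s⇒¬l refl = sym (trans (+-identityʳ _) (+-identityʳ w))
split-by-S-and-last false true  w _ = sym (+-identityˡ w)
split-by-S-and-last false false w _ = sym (trans (+-identityʳ _) (+-identityˡ w))

neg-masked-≤ : (s l nl : Bool) (w : ℤ) → l ≡ true →
  - (if not s ∧ nl then w else 0ℤ) ℤ.≤
  + (if not s ∧ l ∧ nl ∧ ⌊ w ℤ.<? 0ℤ ⌋ then ∣ w ∣ else 0)
neg-masked-≤ true  l    nl    w _    = ≤-refl
neg-masked-≤ false l    false w refl = ≤-refl
neg-masked-≤ false l    true  w refl with w ℤ.<? 0ℤ
... | yes _   = -i≤+∣i∣ w
... | no w≮0 = neg-mono-≤ (≮⇒≥ w≮0)

⌊⌋-true : ∀ {A : Set} (a? : Dec A) → A → ⌊ a? ⌋ ≡ true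
⌊⌋-true a? a = trans (isYes≗does a?) (dec-true a? a)

⌊⌋-false : ∀ {A : Set} (a? : Dec A) → ¬ A → ⌊ a? ⌋ ≡ false
⌊⌋-false a? ¬a = trans (isYes≗does a?) (dec-false a? ¬a)

isLast : ∀ {n} → Fin (suc n) → Bool
isLast {n} j = ⌊ col j ≟ suc n ⌋

col≡1+n⇒lastCol : ∀ {n} {j : Fin (suc n)} → col j ≡ suc n → j ≡ lastCol
col≡1+n⇒lastCol {n} eq = toℕ-injective (trans (ℕ.suc-injective eq) (sym (toℕ-fromℕ n)))

isLast-lastCol : ∀ {n} → isLast (lastCol {n}) ≡ true
isLast-lastCol {n} = ⌊⌋-true (col (lastCol {n}) ≟ suc n) (cong suc (toℕ-fromℕ n))

isLast-inject₁ : ∀ {n} (k : Fin n) → isLast (inject₁ k) ≡ false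
isLast-inject₁ {n} k =
  ⌊⌋-false (col (inject₁ k) ≟ suc n) (λ eq → fromℕ≢inject₁ (sym (col≡1+n⇒lastCol eq)))

inS⇒¬isLast : ∀ {n} (i : Fin n) (j : Fin (suc n)) → inS? i j ≡ true → isLast j ≡ false
inS⇒¬isLast {n} i j ij∈S = ⌊⌋-false (col j ≟ suc n) λ eq →
  ℕ.<⇒≱ (ℕ.m<n+m (suc n) ℕ.z<s)
    (subst (λ c → row i ℕ.+ c ≤ suc n) eq (toWitness (subst T (sym ij∈S) tt)))

inS?-firstCol : ∀ {n} (i : Fin n) → inS? i firstCol ≡ true
inS?-firstCol {n} i = ⌊⌋-true (row i ℕ.+ col (firstCol {n}) ≤? suc n)
  (ℕ.s≤s (subst (_≤ n) (ℕ.+-comm 1 (toℕ i)) (toℕ<n i)))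

sum-lastCol : ∀ {n} (f : Fin (suc n) → ℤ) → sum (λ j → if isLast j then f j else 0ℤ) ≡ f lastCol
sum-lastCol {n} f = begin
  sum masked                                 ≡⟨ sum-init-last masked ⟩
  sum (masked ∘ inject₁) + masked lastCol    ≡⟨ cong₂ _+_ init≡0 (cong (λ b → if b then f lastCol else 0ℤ) isLast-lastCol) ⟩
  0ℤ + f lastCol                             ≡⟨ +-identityˡ (f lastCol) ⟩
  f lastCol                                  ∎
  where
  open ≡-Reasoning
  masked : Fin (suc n) → ℤ
  masked j = if isLast j then f j else 0ℤ
  init≡0 : sum (masked ∘ inject₁) ≡ 0ℤ
  init≡0 = trans (sum-cong-≗ λ k → cong (λ b → if b then f (inject₁ k) else 0ℤ) (isLast-inject₁ k))
                 (sum-replicate-zero n)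

module _ {n : ℕ} (z : Fin n → Fin (suc n) → ℤ) where

  rowS : Fin n → ℤ
  rowS i = sum (λ j → if inS? i j then z i j else 0ℤ)

  rowS̄ : Fin n → ℤ
  rowS̄ i = sum (λ j → if not (inS? i j) ∧ not (isLast j) then z i j else 0ℤ)

  SbarMinusRow : Fin n → Fin n → ℕ
  SbarMinusRow i₁ i = Σ (λ j → if inSbarMinus? z i₁ i j then ∣ z i j ∣ else 0)

  row-split : ∀ i → sum (z i) ≡ rowS i + rowS̄ i + z i lastCol
  row-split i = begin
    sum (z i)                                  ≡⟨ sum-cong-≗ (λ j → split-by-S-and-last (inS? i j) (isLast j) (z i j) (inS⇒¬isLast i j)) ⟩
    sum (λ j → inS j + offS j + last j)        ≡⟨ ∑-distrib-+ (λ j → inS j + offS j) last ⟩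
    sum (λ j → inS j + offS j) + sum last      ≡⟨ cong₂ _+_ (∑-distrib-+ inS offS) (sum-lastCol (z i)) ⟩
    rowS i + rowS̄ i + z i lastCol              ∎
    where
    open ≡-Reasoning
    inS offS last : Fin (suc n) → ℤ
    inS  j = if inS? i j then z i j else 0ℤ
    offS j = if not (inS? i j) ∧ not (isLast j) then z i j else 0ℤ
    last j = if isLast j then z i j else 0ℤ

  rowS-≤-firstCol : ∀ i → (∀ j → inS? i j ≡ true → z i j ℤ.≤ 0ℤ) → rowS i ℤ.≤ z i firstCol
  rowS-≤-firstCol i S≤0 = begin
    rowS i                                              ≡⟨ cong (λ b → (if b then z i fzero else 0ℤ) + rest) (inS?-firstCol i) ⟩
    z i fzero + rest                                    ≤⟨ +-nonpos-≤ (z i fzero) (sum-nonpos λ j → masked-≤0 (inS? i (fsuc j)) (S≤0 _)) ⟩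
    z i firstCol                                        ∎
    where
    open ≤-Reasoning
    rest : ℤ
    rest = sum (λ j → if inS? i (fsuc j) then z i (fsuc j) else 0ℤ)

  -rowS̄-≤-SbarMinusRow : ∀ {i₁} i → row i < row i₁ → - rowS̄ i ℤ.≤ + SbarMinusRow i₁ i
  -rowS̄-≤-SbarMinusRow {i₁} i i<i₁ = begin
    - rowS̄ i          ≡⟨ sum-neg (λ j → if not (inS? i j) ∧ not (isLast j) then z i j else 0ℤ) ⟨
    sum (λ j → - (if not (inS? i j) ∧ not (isLast j) then z i j else 0ℤ))
                      ≤⟨ sum-mono-≤ (λ j → neg-masked-≤ (inS? i j) _ (not (isLast j)) (z i j) above) ⟩
    sum (λ j → + (if inSbarMinus? z i₁ i j then ∣ z i j ∣ else 0))
                      ≡⟨ pos-Σ (λ j → if inSbarMinus? z i₁ i j then ∣ z i j ∣ else 0) ⟨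
    + SbarMinusRow i₁ i ∎
    where
    open ≤-Reasoning
    above : ⌊ row i <? row i₁ ⌋ ≡ true
    above = ⌊⌋-true (row i <? row i₁) i<i₁

  rowS+lastCol≡-rowS̄ : ∀ i → sum (z i) ≡ 0ℤ → rowS i + z i lastCol ≡ - rowS̄ i
  rowS+lastCol≡-rowS̄ i row≡0 = x+y+c≡0⇒x+c≡-y {rowS i} {rowS̄ i} (trans (sym (row-split i)) row≡0)

  excess : Fin n → Fin n → ℤ
  excess i₁ i = rowS i + z i lastCol - + SbarMinusRow i₁ i

  sum-excess : ∀ i₁ → sum rowS ≡ 0ℤ → sum (λ i → z i lastCol) ≡ 0ℤ →
               sum (excess i₁) ≡ - + SbarMinusSum z i₁
  sum-excess i₁ S≡0 lastCol≡0 = begin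
    sum (excess i₁)                                ≡⟨ ∑-distrib-+ u (λ i → - + SbarMinusRow i₁ i) ⟩
    sum u + sum (λ i → - + SbarMinusRow i₁ i)      ≡⟨ cong₂ _+_ (∑-distrib-+ rowS (λ i → z i lastCol)) (sum-neg (λ i → + SbarMinusRow i₁ i)) ⟩
    sum rowS + sum (λ i → z i lastCol) - sum (λ i → + SbarMinusRow i₁ i)
                                                   ≡⟨ cong₂ _-_ (cong₂ _+_ S≡0 lastCol≡0) (sym (pos-Σ (SbarMinusRow i₁))) ⟩
    0ℤ - + SbarMinusSum z i₁                       ≡⟨ +-identityˡ _ ⟩
    - + SbarMinusSum z i₁                          ∎
    where
    open ≡-Reasoning
    u : Fin n → ℤ
    u i = rowS i + z i lastCol

  excess-above : ∀ {i₁} i → sum (z i) ≡ 0ℤ → row i < row i₁ → excess i₁ i ℤ.≤ 0ℤ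
  excess-above i row≡0 i<i₁ =
    i≤j⇒i-j≤0 (≤-trans (≤-reflexive (rowS+lastCol≡-rowS̄ i row≡0)) (-rowS̄-≤-SbarMinusRow i i<i₁))

  excess-≤-corner : ∀ i₁ i → (∀ j → inS? i j ≡ true → z i j ℤ.≤ 0ℤ) →
                    excess i₁ i ℤ.≤ z i firstCol + z i lastCol
  excess-≤-corner i₁ i S≤0 = ≤-trans (i-j≤i (rowS i + z i lastCol) (+ SbarMinusRow i₁ i))
                                     (+-monoˡ-≤ (z i lastCol) (rowS-≤-firstCol i S≤0))

  corner-≤-SbarMinusSum :
    (∀ i → sum (z i) ≡ 0ℤ) → sum (λ i → z i lastCol) ≡ 0ℤ → sum rowS ≡ 0ℤ →
    (i₁ : Fin n) →
    (∀ i → row i > row i₁ → z i firstCol ≡ 0ℤ × z i lastCol ≡ 0ℤ) →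
    (∀ i j → inS? i j ≡ true → row i ≥ row i₁ → z i j ℤ.≤ 0ℤ) →
    - (z i₁ firstCol + z i₁ lastCol) ℤ.≤ + SbarMinusSum z i₁
  corner-≤-SbarMinusSum rows≡0 lastCol≡0 S≡0 i₁ below S≤0 = begin
    - (z i₁ firstCol + z i₁ lastCol)  ≤⟨ neg-mono-≤ (excess-≤-corner i₁ i₁ λ j ij∈S → S≤0 i₁ j ij∈S ℕ.≤-refl) ⟩
    - excess i₁ i₁                    ≤⟨ neg-mono-≤ (sum-≤-at i₁ excess-others) ⟩
    - sum (excess i₁)                 ≡⟨ cong -_ (sum-excess i₁ S≡0 lastCol≡0) ⟩
    - - + SbarMinusSum z i₁           ≡⟨ neg-involutive _ ⟩
    + SbarMinusSum z i₁               ∎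
    where
    open ≤-Reasoning
    excess-others : ∀ i → i ≢ i₁ → excess i₁ i ℤ.≤ 0ℤ
    excess-others i i≢i₁ with ℕ.<-cmp (row i) (row i₁)
    ... | tri< i<i₁ _ _ = excess-above i (rows≡0 i) i<i₁
    ... | tri≈ _ i≡i₁ _ = contradiction (toℕ-injective (ℕ.suc-injective i≡i₁)) i≢i₁
    ... | tri> _ _ i>i₁ = ≤-trans (excess-≤-corner i₁ i λ j ij∈S → S≤0 i j ij∈S (ℕ.<⇒≤ i>i₁))
                                  (≤-reflexive (uncurry (cong₂ _+_) (below i i>i₁)))

rowS-diff : ∀ {n} (X Y : Table n) (i : Fin n) →
  rowS (diff X Y) i ≡ + Σ (λ j → if inS? i j then X i j else 0) - + Σ (λ j → if inS? i j then Y i j else 0)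
rowS-diff X Y i = trans (sum-cong-≗ λ j → masked-sub (inS? i j) (X i j) (Y i j))
  (sum-sub-pos (λ j → if inS? i j then X i j else 0) (λ j → if inS? i j then Y i j else 0))

lemma8 : (n : ℕ) → 2 ≤ n → (X Y : Table n) →
    ¬ ((i : Fin n) (j : Fin (suc n)) → X i j ≡ Y i j) →
    SameFiber X Y →
    (Σ[ i₀ ∈ ℕ ] (1 ≤ i₀ × i₀ ≤ n ×
      ((i : Fin n) → row i ≤ i₀ →
        + 0 ℤ.≤ diff X Y i firstCol × + 0 ℤ.≤ diff X Y i lastCol) ×
      ((i : Fin n) → row i > i₀ →
        diff X Y i firstCol ℤ.≤ + 0 × diff X Y i lastCol ℤ.≤ + 0))) →
    (i₁ : Fin n) →
    diff X Y i₁ firstCol ℤ.≤ + 0 →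
    diff X Y i₁ lastCol ℤ.≤ + 0 →
    (diff X Y i₁ firstCol ℤ.< + 0 ⊎ diff X Y i₁ lastCol ℤ.< + 0) →
    ((i : Fin n) → row i > row i₁ →
      diff X Y i firstCol ≡ + 0 × diff X Y i lastCol ≡ + 0) →
    ((i : Fin n) (j : Fin (suc n)) → inS? i j ≡ true →
      row i ≥ row i₁ → diff X Y i j ℤ.≤ + 0) →
    ∣ diff X Y i₁ firstCol + diff X Y i₁ lastCol ∣ ≤ SbarMinusSum (diff X Y) i₁
lemma8 n _ X Y _ (rowSums , colSums , SSums) _ i₁ first≤0 last≤0 _ below S≤0 = drop‿+≤+ (begin
  + ∣ z i₁ firstCol + z i₁ lastCol ∣  ≡⟨ i≤0⇒+∣i∣≡-i (+-mono-≤ first≤0 last≤0) ⟩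
  - (z i₁ firstCol + z i₁ lastCol)    ≤⟨ corner-≤-SbarMinusSum z rows≡0 lastCol≡0 S≡0 i₁ below S≤0 ⟩
  + SbarMinusSum z i₁                 ∎)
  where
  open ≤-Reasoning
  z : Fin n → Fin (suc n) → ℤ
  z = diff X Y
  rows≡0 : ∀ i → sum (z i) ≡ 0ℤ
  rows≡0 i = sum-sub-pos-≡0 (X i) (Y i) (rowSums i)
  lastCol≡0 : sum (λ i → z i lastCol) ≡ 0ℤ
  lastCol≡0 = sum-sub-pos-≡0 (λ i → X i lastCol) (λ i → Y i lastCol) (colSums lastCol)
  S≡0 : sum (rowS z) ≡ 0ℤ
  S≡0 = trans (sum-cong-≗ (rowS-diff X Y))
    (sum-sub-pos-≡0 (λ i → Σ (λ j → if inS? i j then X i j else 0))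
                    (λ i → Σ (λ j → if inS? i j then Y i j else 0)) SSums)
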